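{- Let $n,r$ be positive integers with $r\ge n$, and let $\mathcal F$ be the $f$-triangle of size $n$ of the $r$-fold edgewise subdivision. Then for $k\in\{0,\dots,n\}$ $$p_{\mathcal F,n,k}(x)=\mathcal S^r_0\big(x^k(1+x+\cdots+x^{r-1})^n\big),\qquad \ell_{\mathcal F,n,k}(x)=\mathcal S^r_0\big((1+x+\cdots+x^{r-1})^{n-k}(x+x^2+\cdots+x^{r-1})^k\big),$$ and for $k,j\in\{0,\dots,n\}$ with $k+j\le n$ $$\ell_{\mathcal F,n,k,j}(x)=\mathcal S^r_0\big(x^j(1+x+\cdots+x^{r-1})^{n-k}(x+x^2+\cdots+x^{r-1})^k\big).$$
   Context: $\mathcal S^r_0$ is the Veronese operator $\mathcal S^r_0(\sum_{m\ge0}a_mx^m)=\sum_{m\ge0}a_{rm}x^m$. The $r$-fold edgewise subdivision is a uniform triangulation: for every $(j-1)$-dimensional face $F$ of the subdivided complex, the number of $(i-1)$-dimensional faces of the restriction to $F$ depends only on $i,j$; $\mathcal F=(f(i,j))_{0\le i\le j\le n}$ records these numbers. For $0\le m\le n$, $h_{\mathcal F}(\sigma_m,x)$ is the $h$-polynomial of the $r$-fold edgewise subdivision of the $(m-1)$-dimensional simplex, equal to $\mathcal S^r_0\big((1+x+\cdots+x^{r-1})^m\big)$ (with $h$-polynomial $h(K,x)=\sum_{i=0}^d f_{i-1}(K)x^i(1-x)^{d-i}$, $f_{ -1}=1$). Define $p_{\mathcal F,m,k}(x)=\sum_{i=0}^k\binom{k}{i}(x-1)^ih_{\mathcal F}(\sigma_{m-i},x)$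 for $0\le k\le m$; $\ell_{\mathcal F,m,k}(x)=\sum_{i=0}^k(-1)^i\binom{k}{i}h_{\mathcal F}(\sigma_{m-i},x)$; and $\ell_{\mathcal F,m,k,j}(x)=\sum_{i=0}^k(-1)^i\binom{k}{i}p_{\mathcal F,m-i,j}(x)$ for $k+j\le m$. -}

module Defs where

open import Data.Nat as ℕ using (ℕ; zero; suc; _∸_; _<ᵇ_)
open import Data.Nat.Combinatorics using (_C_)
open import Data.Integer using (ℤ; +_; -_; _+_; _*_; 0ℤ; 1ℤ)
open import Data.Bool using (Bool; true; false; if_then_else_; _∧_)
open import Relation.Binary.PropositionalEquality using (_≡_)

-- Formal power series (in particular polynomials) in x with integer
-- coefficients, represented by their coefficient sequence.
Poly : Set
Poly = ℕ → ℤ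

infix 4 _≋_
_≋_ : Poly → Poly → Set
f ≋ g = ∀ m → f m ≡ g m

sumTo : ℕ → (ℕ → ℤ) → ℤ
sumTo zero f = f 0
sumTo (suc n) f = sumTo n f + f (suc n)

zeroP : Poly
zeroP _ = 0ℤ

const : ℤ → Poly
const c zero = c
const c (suc _) = 0ℤ

X^ : ℕ → Poly
X^ k m = if (k ℕ.≡ᵇ m) then 1ℤ else 0ℤ

infixl 6 _⊕_
infixl 7 _⊛_ _·_
_⊕_ : Poly → Poly → Poly
(f ⊕ g) m = f m + g m

_·_ : ℤ → Poly → Poly
(c · f) m = c * f m

_⊛_ : Poly → Poly → Poly
(f ⊛ g) m = sumTo m (λ i → f i * g (m ∸ i))

_^P_ : Poly → ℕ → Poly
f ^P zero = const 1ℤ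
f ^P suc n = f ⊛ (f ^P n)

sumP : ℕ → (ℕ → Poly) → Poly
sumP k F m = sumTo k (λ i → F i m)

geom : ℕ → Poly
geom r m = if m <ᵇ r then 1ℤ else 0ℤ

geom₁ : ℕ → Poly
geom₁ r m = if (0 <ᵇ m) ∧ (m <ᵇ r) then 1ℤ else 0ℤ

xMinus1 : Poly
xMinus1 = X^ 1 ⊕ const (- 1ℤ)

S0 : ℕ → Poly → Poly
S0 r f m = f (r ℕ.* m)

sign : ℕ → ℤ
sign zero = 1ℤ
sign (suc i) = - sign i

-- h_F(σ_m, x) for F the f-triangle of the r-fold edgewise subdivision:
-- the h-polynomial of the r-fold edgewise subdivision of the (m-1)-simplex,
-- which equals S^r_0((1+x+...+x^{r-1})^m).
hσ : (r m : ℕ) → Poly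
hσ r m = S0 r (geom r ^P m)

pF : (r m k : ℕ) → Poly
pF r m k = sumP k (λ i → (+ (k C i)) · ((xMinus1 ^P i) ⊛ hσ r (m ∸ i)))

ℓF : (r m k : ℕ) → Poly
ℓF r m k = sumP k (λ i → (sign i * + (k C i)) · hσ r (m ∸ i))

ℓF₂ : (r m k j : ℕ) → Poly
ℓF₂ r m k j = sumP k (λ i → (sign i * + (k C i)) · pF r (m ∸ i) j)

-- In the ring of integer power series x ⊛ S^r_0 F = S^r_0 (x^r ⊛ F) for r ≥ 1, so the factor
-- (x-1)^i in front of h(σ_{m-i}) = S^r_0 (G^{m-i}), G = 1+x+⋯+x^{r-1}, moves inside the
-- Veronese operator as (x^r-1)^i.  Writing G^{n-i} = G^{n-k} G^{k-i}, each of the three sums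
-- becomes S^r_0 of G^{n-k} times a binomial expansion: (x^r - 1 + G)^k = (x G)^k for p, and
-- (G - 1)^k = (x+⋯+x^{r-1})^k for ℓ; since p_{m,j} = S^r_0 (x^j G^m), the double sum
-- ℓ_{F,n,k,j} is ℓ with x^j factored out.
module Submission where

open import Defs
open import Data.Nat using (ℕ; zero; suc; _≤_; _<_; _+_; _*_; _∸_; z≤n; z<s; NonZero; >-nonZero⁻¹)
import Data.Nat.Properties as ℕ
open import Data.Nat.Combinatorics using (_C_)
open import Data.Integer as ℤ using (ℤ; +_; -_; 0ℤ; 1ℤ)
import Data.Integer.Properties as ℤ
open import Data.Fin using (toℕ)
open import Data.Product using (_×_; _,_)
open import Data.Sum using (inj₁; inj₂)
open import Data.Empty using (⊥-elim)
open import Relation.Binary.PropositionalEquality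
  using (_≡_; _≢_; refl; sym; trans; cong; cong₂; isEquivalence; module ≡-Reasoning)
import Algebra.Properties.CommutativeSemigroup as CommSemigroupProperties
open import Level using (0ℓ)
open import Algebra.Bundles using (CommutativeSemiring)
open import Algebra.Structures {A = Poly} _≋_ using (IsCommutativeSemiring)
open import Algebra.Structures.Biased {A = Poly} _≋_ using (isCommutativeMonoidˡ; isCommutativeSemiringˡ)
import Algebra.Construct.Pointwise ℕ as Pointwise

open CommSemigroupProperties ℤ.+-commutativeSemigroup using (interchange)
open CommSemigroupProperties ℤ.*-commutativeSemigroup using (x∙yz≈y∙xz)

sumTo-cong-≤ : ∀ m {f g : ℕ → ℤ} → (∀ i → i ≤ m → f i ≡ g i) → sumTo m f ≡ sumTo m g
sumTo-cong-≤ zero     f≗g = f≗g 0 z≤n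
sumTo-cong-≤ (suc m) f≗g =
  cong₂ ℤ._+_ (sumTo-cong-≤ m (λ i i≤m → f≗g i (ℕ.m≤n⇒m≤1+n i≤m))) (f≗g (suc m) ℕ.≤-refl)

sumTo-cong : ∀ m {f g : ℕ → ℤ} → (∀ i → f i ≡ g i) → sumTo m f ≡ sumTo m g
sumTo-cong m f≗g = sumTo-cong-≤ m (λ i _ → f≗g i)

sumTo-+ : ∀ m (f g : ℕ → ℤ) → sumTo m (λ i → f i ℤ.+ g i) ≡ sumTo m f ℤ.+ sumTo m g
sumTo-+ zero    f g = refl
sumTo-+ (suc m) f g =
  trans (cong (ℤ._+ (f (suc m) ℤ.+ g (suc m))) (sumTo-+ m f g)) (interchange (sumTo m f) (sumTo m g) _ _)

sumTo-*ˡ : ∀ m c (f : ℕ → ℤ) → c ℤ.* sumTo m f ≡ sumTo m (λ i → c ℤ.* f i)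
sumTo-*ˡ zero    c f = refl
sumTo-*ˡ (suc m) c f =
  trans (ℤ.*-distribˡ-+ c (sumTo m f) (f (suc m))) (cong (ℤ._+ (c ℤ.* f (suc m))) (sumTo-*ˡ m c f))

sumTo-*ʳ : ∀ m c (f : ℕ → ℤ) → sumTo m f ℤ.* c ≡ sumTo m (λ i → f i ℤ.* c)
sumTo-*ʳ zero    c f = refl
sumTo-*ʳ (suc m) c f =
  trans (ℤ.*-distribʳ-+ c (sumTo m f) (f (suc m))) (cong (ℤ._+ (f (suc m) ℤ.* c)) (sumTo-*ʳ m c f))

sumTo-zero : ∀ m → sumTo m (λ _ → 0ℤ) ≡ 0ℤ
sumTo-zero zero    = refl
sumTo-zero (suc m) = cong (ℤ._+ 0ℤ) (sumTo-zero m)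

sumTo-suc : ∀ m (f : ℕ → ℤ) → sumTo (suc m) f ≡ f 0 ℤ.+ sumTo m (λ i → f (suc i))
sumTo-suc zero    f = refl
sumTo-suc (suc m) f = trans (cong (ℤ._+ f (suc (suc m))) (sumTo-suc m f)) (ℤ.+-assoc (f 0) _ _)

sumTo-reverse : ∀ m (f : ℕ → ℤ) → sumTo m f ≡ sumTo m (λ i → f (m ∸ i))
sumTo-reverse zero    f = refl
sumTo-reverse (suc m) f = begin
  sumTo m f ℤ.+ f (suc m)                 ≡⟨ cong (ℤ._+ f (suc m)) (sumTo-reverse m f) ⟩
  sumTo m (λ i → f (m ∸ i)) ℤ.+ f (suc m) ≡⟨ ℤ.+-comm _ (f (suc m)) ⟩
  f (suc m) ℤ.+ sumTo m (λ i → f (m ∸ i)) ≡⟨ sumTo-suc m (λ i → f (suc m ∸ i)) ⟨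
  sumTo (suc m) (λ i → f (suc m ∸ i))     ∎
  where open ≡-Reasoning

sumTo-triangle : ∀ m (A : ℕ → ℕ → ℤ) →
  sumTo m (λ i → sumTo i (A i)) ≡ sumTo m (λ j → sumTo (m ∸ j) (λ l → A (j + l) j))
sumTo-triangle zero    A = refl
sumTo-triangle (suc m) A = sym (begin
  sumTo m (λ j → column (suc m) j) ℤ.+ column (suc m) (suc m)
    ≡⟨ cong₂ ℤ._+_ (sumTo-cong-≤ m column-suc) last-column ⟩
  sumTo m (λ j → column m j ℤ.+ A (suc m) j) ℤ.+ A (suc m) (suc m)
    ≡⟨ cong (ℤ._+ A (suc m) (suc m)) (sumTo-+ m (column m) (A (suc m))) ⟩
  (sumTo m (column m) ℤ.+ sumTo m (A (suc m))) ℤ.+ A (suc m) (suc m)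
    ≡⟨ ℤ.+-assoc (sumTo m (column m)) _ _ ⟩
  sumTo m (column m) ℤ.+ sumTo (suc m) (A (suc m))
    ≡⟨ cong (ℤ._+ sumTo (suc m) (A (suc m))) (sumTo-triangle m A) ⟨
  sumTo m (λ i → sumTo i (A i)) ℤ.+ sumTo (suc m) (A (suc m)) ∎)
  where
  open ≡-Reasoning
  column : ℕ → ℕ → ℤ
  column m j = sumTo (m ∸ j) (λ l → A (j + l) j)

  last-column : column (suc m) (suc m) ≡ A (suc m) (suc m)
  last-column rewrite ℕ.n∸n≡0 m | ℕ.+-identityʳ m = refl

  column-suc : ∀ j → j ≤ m → column (suc m) j ≡ column m j ℤ.+ A (suc m) j
  column-suc j j≤m rewrite ℕ.+-∸-assoc 1 j≤m =
    cong (λ i → column m j ℤ.+ A i j) (trans (ℕ.+-suc j (m ∸ j)) (cong suc (ℕ.m+[n∸m]≡n j≤m)))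

⊛-cong : ∀ {f f′ g g′} → f ≋ f′ → g ≋ g′ → f ⊛ g ≋ f′ ⊛ g′
⊛-cong f≋f′ g≋g′ m = sumTo-cong m (λ i → cong₂ ℤ._*_ (f≋f′ i) (g≋g′ (m ∸ i)))

⊛-comm : ∀ f g → f ⊛ g ≋ g ⊛ f
⊛-comm f g m = trans (sumTo-reverse m _) (sumTo-cong-≤ m (λ i i≤m →
  trans (ℤ.*-comm (f (m ∸ i)) _) (cong (λ j → g j ℤ.* f (m ∸ i)) (ℕ.m∸[m∸n]≡n i≤m))))

⊛-assoc : ∀ f g h → (f ⊛ g) ⊛ h ≋ f ⊛ (g ⊛ h)
⊛-assoc f g h m = begin
  sumTo m (λ i → sumTo i (λ j → f j ℤ.* g (i ∸ j)) ℤ.* h (m ∸ i))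
    ≡⟨ sumTo-cong m (λ i → sumTo-*ʳ i (h (m ∸ i)) _) ⟩
  sumTo m (λ i → sumTo i (λ j → f j ℤ.* g (i ∸ j) ℤ.* h (m ∸ i)))
    ≡⟨ sumTo-triangle m _ ⟩
  sumTo m (λ j → sumTo (m ∸ j) (λ l → f j ℤ.* g (j + l ∸ j) ℤ.* h (m ∸ (j + l))))
    ≡⟨ sumTo-cong m (λ j → sumTo-cong (m ∸ j) (λ l →
         trans (cong₂ (λ a b → f j ℤ.* g a ℤ.* h b) (ℕ.m+n∸m≡n j l) (sym (ℕ.∸-+-assoc m j l)))
               (ℤ.*-assoc (f j) (g l) _))) ⟩
  sumTo m (λ j → sumTo (m ∸ j) (λ l → f j ℤ.* (g l ℤ.* h (m ∸ j ∸ l))))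
    ≡⟨ sumTo-cong m (λ j → sumTo-*ˡ (m ∸ j) (f j) _) ⟨
  sumTo m (λ j → f j ℤ.* sumTo (m ∸ j) (λ l → g l ℤ.* h (m ∸ j ∸ l))) ∎
  where open ≡-Reasoning

const-⊛ : ∀ c f → const c ⊛ f ≋ c · f
const-⊛ c f zero    = refl
const-⊛ c f (suc m) =
  trans (sumTo-suc m _) (trans (cong (ℤ._+_ (c ℤ.* f (suc m))) (sumTo-zero m)) (ℤ.+-identityʳ _))

⊛-distribʳ : ∀ f g h → (g ⊕ h) ⊛ f ≋ (g ⊛ f) ⊕ (h ⊛ f)
⊛-distribʳ f g h m = trans (sumTo-cong m (λ i → ℤ.*-distribʳ-+ (f (m ∸ i)) (g i) (h i))) (sumTo-+ m _ _)

⊕-⊛-isCommutativeSemiring : IsCommutativeSemiring _⊕_ _⊛_ zeroP (const 1ℤ)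
⊕-⊛-isCommutativeSemiring = isCommutativeSemiringˡ record
  { +-isCommutativeMonoid = Pointwise.isCommutativeMonoid ℤ.+-0-isCommutativeMonoid
  ; *-isCommutativeMonoid = isCommutativeMonoidˡ record
    { isSemigroup = record
      { isMagma = record { isEquivalence = Pointwise.isEquivalence isEquivalence ; ∙-cong = ⊛-cong }
      ; assoc   = ⊛-assoc
      }
    ; identityˡ = λ f m → trans (const-⊛ 1ℤ f m) (ℤ.*-identityˡ (f m))
    ; comm      = ⊛-comm
    }
  ; distribʳ = ⊛-distribʳ
  ; zeroˡ    = λ f m → sumTo-zero m
  }

⊕-⊛-commutativeSemiring : CommutativeSemiring 0ℓ 0ℓ
⊕-⊛-commutativeSemiring = record { isCommutativeSemiring = ⊕-⊛-isCommutativeSemiring }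

open CommutativeSemiring ⊕-⊛-commutativeSemiring
  using (setoid; semiring; *-identityˡ; distribˡ)
  renaming (refl to ≋-refl; sym to ≋-sym; trans to ≋-trans; +-cong to ⊕-cong)
open import Relation.Binary.Reasoning.Setoid setoid
open import Algebra.Properties.Semiring.Exp semiring using (_^_; ^-homo-*)
open import Algebra.Properties.CommutativeSemiring.Exp ⊕-⊛-commutativeSemiring using (^-distrib-*)
open import Algebra.Properties.Semiring.Mult semiring using () renaming (_×_ to _×ₘ_)
open import Algebra.Properties.Semiring.Sum semiring using (sum)
import Algebra.Properties.CommutativeSemiring.Binomial ⊕-⊛-commutativeSemiring as Binomial
open CommSemigroupProperties
  (CommutativeSemiring.*-commutativeSemigroup ⊕-⊛-commutativeSemiring)
  using () renaming (x∙yz≈y∙xz to ⊛-left-comm)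

⊛-congˡ : ∀ f {g g′} → g ≋ g′ → f ⊛ g ≋ f ⊛ g′
⊛-congˡ f = ⊛-cong {f} {f} ≋-refl

⊛-congʳ : ∀ {f f′} g → f ≋ f′ → f ⊛ g ≋ f′ ⊛ g
⊛-congʳ g f≋f′ = ⊛-cong f≋f′ (≋-refl {g})

·-cong : ∀ c {f g} → f ≋ g → c · f ≋ c · g
·-cong c f≋g m = cong (c ℤ.*_) (f≋g m)

⊛-· : ∀ f c g → f ⊛ (c · g) ≋ c · (f ⊛ g)
⊛-· f c g m =
  trans (sumTo-cong m (λ i → x∙yz≈y∙xz (f i) c (g (m ∸ i)))) (sym (sumTo-*ˡ m c _))

·-·-assoc : ∀ a b f → (a ℤ.* b) · f ≋ a · (b · f)
·-·-assoc a b f m = ℤ.*-assoc a b (f m)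

sumP-cong : ∀ k {F G : ℕ → Poly} → (∀ i → i ≤ k → F i ≋ G i) → sumP k F ≋ sumP k G
sumP-cong k F≋G m = sumTo-cong-≤ k (λ i i≤k → F≋G i i≤k m)

⊛-sumP : ∀ f k (F : ℕ → Poly) → f ⊛ sumP k F ≋ sumP k (λ i → f ⊛ F i)
⊛-sumP f zero    F = ≋-refl
⊛-sumP f (suc k) F = ≋-trans (distribˡ f (sumP k F) (F (suc k))) (⊕-cong (⊛-sumP f k F) ≋-refl)

^P-cong : ∀ {f g} n → f ≋ g → f ^P n ≋ g ^P n
^P-cong zero    f≋g = ≋-refl
^P-cong (suc n) f≋g = ⊛-cong f≋g (^P-cong n f≋g)

^≋^P : ∀ f n → f ^ n ≋ f ^P n
^≋^P f zero    = ≋-refl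
^≋^P f (suc n) = ⊛-congˡ f (^≋^P f n)

^P-+ : ∀ f a b → f ^P (a + b) ≋ (f ^P a) ⊛ (f ^P b)
^P-+ f a b = begin
  f ^P (a + b)      ≈⟨ ^≋^P f (a + b) ⟨
  f ^ (a + b)       ≈⟨ ^-homo-* f a b ⟩
  (f ^ a) ⊛ (f ^ b) ≈⟨ ⊛-cong (^≋^P f a) (^≋^P f b) ⟩
  (f ^P a) ⊛ (f ^P b) ∎

^P-distrib-⊛ : ∀ f g n → (f ⊛ g) ^P n ≋ (f ^P n) ⊛ (g ^P n)
^P-distrib-⊛ f g n = begin
  (f ⊛ g) ^P n      ≈⟨ ^≋^P (f ⊛ g) n ⟨
  (f ⊛ g) ^ n       ≈⟨ ^-distrib-* f g n ⟩
  (f ^ n) ⊛ (g ^ n) ≈⟨ ⊛-cong (^≋^P f n) (^≋^P g n) ⟩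
  (f ^P n) ⊛ (g ^P n) ∎

^P-∸-split : ∀ f {n k i} → k ≤ n → i ≤ k → f ^P (n ∸ i) ≋ (f ^P (n ∸ k)) ⊛ (f ^P (k ∸ i))
^P-∸-split f {n} {k} {i} k≤n i≤k m = trans (cong (λ e → (f ^P e) m) n∸i≡) (^P-+ f (n ∸ k) (k ∸ i) m)
  where
  n∸i≡ : n ∸ i ≡ (n ∸ k) + (k ∸ i)
  n∸i≡ = trans (cong (_∸ i) (sym (ℕ.m∸n+n≡m k≤n))) (ℕ.+-∸-assoc (n ∸ k) i≤k)

×ₘ≋· : ∀ n f → n ×ₘ f ≋ (+ n) · f
×ₘ≋· zero    f m = refl
×ₘ≋· (suc n) f m = trans (cong (ℤ._+_ (f m)) (×ₘ≋· n f m))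
  (trans (cong (ℤ._+ (+ n) ℤ.* f m) (sym (ℤ.*-identityˡ (f m)))) (sym (ℤ.*-distribʳ-+ (f m) 1ℤ (+ n))))

sum≋sumP : ∀ n (F : ℕ → Poly) → sum {suc n} (λ i → F (toℕ i)) ≋ sumP n F
sum≋sumP zero    F m = ℤ.+-identityʳ (F 0 m)
sum≋sumP (suc n) F m =
  trans (cong (ℤ._+_ (F 0 m)) (sum≋sumP n (λ i → F (suc i)) m)) (sym (sumTo-suc n (λ i → F i m)))

binomial : ∀ k f g → (f ⊕ g) ^P k ≋ sumP k (λ i → (+ (k C i)) · ((f ^P i) ⊛ (g ^P (k ∸ i))))
binomial k f g = begin
  (f ⊕ g) ^P k
    ≈⟨ ^≋^P (f ⊕ g) k ⟨
  (f ⊕ g) ^ k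
    ≈⟨ Binomial.theorem k f g ⟩
  sum {suc k} (λ i → (k C toℕ i) ×ₘ ((f ^ toℕ i) ⊛ (g ^ (k ∸ toℕ i))))
    ≈⟨ sum≋sumP k (λ i → (k C i) ×ₘ ((f ^ i) ⊛ (g ^ (k ∸ i)))) ⟩
  sumP k (λ i → (k C i) ×ₘ ((f ^ i) ⊛ (g ^ (k ∸ i))))
    ≈⟨ sumP-cong k (λ i _ → ≋-trans (×ₘ≋· (k C i) _)
         (·-cong (+ (k C i)) (⊛-cong (^≋^P f i) (^≋^P g (k ∸ i))))) ⟩
  sumP k (λ i → (+ (k C i)) · ((f ^P i) ⊛ (g ^P (k ∸ i)))) ∎

-- The common factor g^{n-k} is what allows the exponent n - i (rather than k - i) in pF and ℓF.
binomial-⊛ : ∀ f g {n k} → k ≤ n →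
  sumP k (λ i → (+ (k C i)) · ((f ^P i) ⊛ (g ^P (n ∸ i)))) ≋ (g ^P (n ∸ k)) ⊛ ((f ⊕ g) ^P k)
binomial-⊛ f g {n} {k} k≤n = begin
  sumP k (λ i → c i · ((f ^P i) ⊛ (g ^P (n ∸ i))))
    ≈⟨ sumP-cong k (λ i i≤k → ·-cong (c i) (≋-trans
         (⊛-congˡ (f ^P i) (^P-∸-split g k≤n i≤k))
         (⊛-left-comm (f ^P i) B (g ^P (k ∸ i))))) ⟩
  sumP k (λ i → c i · (B ⊛ ((f ^P i) ⊛ (g ^P (k ∸ i)))))
    ≈⟨ sumP-cong k (λ i _ → ⊛-· B (c i) ((f ^P i) ⊛ (g ^P (k ∸ i)))) ⟨
  sumP k (λ i → B ⊛ (c i · ((f ^P i) ⊛ (g ^P (k ∸ i)))))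
    ≈⟨ ⊛-sumP B k (λ i → c i · ((f ^P i) ⊛ (g ^P (k ∸ i)))) ⟨
  B ⊛ sumP k (λ i → c i · ((f ^P i) ⊛ (g ^P (k ∸ i))))
    ≈⟨ ⊛-congˡ B (binomial k f g) ⟨
  B ⊛ ((f ⊕ g) ^P k) ∎
  where
  B = g ^P (n ∸ k)
  c : ℕ → ℤ
  c i = + (k C i)

const-1^P : ∀ i → const (- 1ℤ) ^P i ≋ const (sign i)
const-1^P zero    = ≋-refl
const-1^P (suc i) = ≋-trans (⊛-congˡ (const (- 1ℤ)) (const-1^P i))
  (≋-trans (const-⊛ (- 1ℤ) (const (sign i))) negate)
  where
  negate : (- 1ℤ) · const (sign i) ≋ const (sign (suc i))
  negate zero    = ℤ.-1*i≡-i (sign i)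
  negate (suc m) = refl

alternating-binomial-⊛ : ∀ g {n k} → k ≤ n →
  sumP k (λ i → (sign i ℤ.* + (k C i)) · (g ^P (n ∸ i))) ≋ (g ^P (n ∸ k)) ⊛ ((const (- 1ℤ) ⊕ g) ^P k)
alternating-binomial-⊛ g {n} {k} k≤n = ≋-trans (sumP-cong k signed-term) (binomial-⊛ (const (- 1ℤ)) g k≤n)
  where
  signed-term : ∀ i → i ≤ k →
    (sign i ℤ.* + (k C i)) · (g ^P (n ∸ i)) ≋ (+ (k C i)) · ((const (- 1ℤ) ^P i) ⊛ (g ^P (n ∸ i)))
  signed-term i _ = begin
    (sign i ℤ.* + (k C i)) · (g ^P (n ∸ i))       ≈⟨ (λ m → cong (ℤ._* _) (ℤ.*-comm (sign i) _)) ⟩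
    (+ (k C i) ℤ.* sign i) · (g ^P (n ∸ i))       ≈⟨ ·-·-assoc (+ (k C i)) (sign i) _ ⟩
    (+ (k C i)) · (sign i · (g ^P (n ∸ i)))       ≈⟨ ·-cong (+ (k C i)) (const-⊛ (sign i) (g ^P (n ∸ i))) ⟨
    (+ (k C i)) · (const (sign i) ⊛ (g ^P (n ∸ i))) ≈⟨ ·-cong (+ (k C i)) (⊛-congʳ (g ^P (n ∸ i)) (const-1^P i)) ⟨
    (+ (k C i)) · ((const (- 1ℤ) ^P i) ⊛ (g ^P (n ∸ i))) ∎

X^-diag : ∀ k → X^ k k ≡ 1ℤ
X^-diag zero    = refl
X^-diag (suc k) = X^-diag k

X^-offdiag : ∀ k m → k ≢ m → X^ k m ≡ 0ℤ
X^-offdiag zero    zero    k≢m = ⊥-elim (k≢m refl)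
X^-offdiag zero    (suc m) k≢m = refl
X^-offdiag (suc k) zero    k≢m = refl
X^-offdiag (suc k) (suc m) k≢m = X^-offdiag k m (λ k≡m → k≢m (cong suc k≡m))

sumTo-X^-below : ∀ m k (g : ℕ → ℤ) → m < k → sumTo m (λ i → X^ k i ℤ.* g i) ≡ 0ℤ
sumTo-X^-below m k g m<k = trans (sumTo-cong-≤ m vanish) (sumTo-zero m)
  where
  vanish : ∀ i → i ≤ m → X^ k i ℤ.* g i ≡ 0ℤ
  vanish i i≤m = cong (ℤ._* g i) (X^-offdiag k i (λ k≡i → ℕ.<-irrefl (sym k≡i) (ℕ.≤-<-trans i≤m m<k)))

sumTo-X^-select : ∀ m k (g : ℕ → ℤ) → k ≤ m → sumTo m (λ i → X^ k i ℤ.* g i) ≡ g k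
sumTo-X^-select zero    zero g z≤n = ℤ.*-identityˡ (g 0)
sumTo-X^-select (suc m) k    g k≤1+m with ℕ.m≤n⇒m<n∨m≡n k≤1+m
... | inj₁ k<1+m = trans
  (cong₂ ℤ._+_ (sumTo-X^-select m k g (ℕ.≤-pred k<1+m))
               (cong (ℤ._* g (suc m)) (X^-offdiag k (suc m) (ℕ.<⇒≢ k<1+m))))
  (ℤ.+-identityʳ (g k))
... | inj₂ refl = trans
  (cong₂ ℤ._+_ (sumTo-X^-below m (suc m) g ℕ.≤-refl) (cong (ℤ._* g (suc m)) (X^-diag (suc m))))
  (trans (ℤ.+-identityˡ _) (ℤ.*-identityˡ (g (suc m))))

X^-⊛-below : ∀ k f m → m < k → (X^ k ⊛ f) m ≡ 0ℤ
X^-⊛-below k f m = sumTo-X^-below m k (λ i → f (m ∸ i))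

X^-⊛-shift : ∀ k f m → (X^ k ⊛ f) (k + m) ≡ f m
X^-⊛-shift k f m =
  trans (sumTo-X^-select (k + m) k (λ i → f (k + m ∸ i)) (ℕ.m≤m+n k m)) (cong f (ℕ.m+n∸m≡n k m))

X^1-^P : ∀ k → X^ 1 ^P k ≋ X^ k
X^1-^P zero    zero    = refl
X^1-^P zero    (suc m) = refl
X^1-^P (suc k) = ≋-trans (⊛-congˡ (X^ 1) (X^1-^P k)) X^1-⊛-X^
  where
  X^1-⊛-X^ : X^ 1 ⊛ X^ k ≋ X^ (suc k)
  X^1-⊛-X^ zero    = X^-⊛-below 1 (X^ k) 0 z<s
  X^1-⊛-X^ (suc m) = X^-⊛-shift 1 (X^ k) m

xPowMinus1 : ℕ → Poly
xPowMinus1 r = X^ r ⊕ const (- 1ℤ)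

S0-cong : ∀ r {f g} → f ≋ g → S0 r f ≋ S0 r g
S0-cong r f≋g m = f≋g (r * m)

X-⊛-S0 : ∀ r .{{_ : NonZero r}} F → X^ 1 ⊛ S0 r F ≋ S0 r (X^ r ⊛ F)
X-⊛-S0 r F zero    = trans (X^-⊛-below 1 (S0 r F) 0 z<s)
  (sym (trans (cong (X^ r ⊛ F) (ℕ.*-zeroʳ r)) (X^-⊛-below r F 0 (>-nonZero⁻¹ r))))
X-⊛-S0 r F (suc m) = trans (X^-⊛-shift 1 (S0 r F) m)
  (sym (trans (cong (X^ r ⊛ F) (ℕ.*-suc r m)) (X^-⊛-shift r F (r * m))))

xMinus1-⊛-S0 : ∀ r .{{_ : NonZero r}} F → xMinus1 ⊛ S0 r F ≋ S0 r (xPowMinus1 r ⊛ F)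
xMinus1-⊛-S0 r F = begin
  (X^ 1 ⊕ const (- 1ℤ)) ⊛ S0 r F
    ≈⟨ ⊛-distribʳ (S0 r F) (X^ 1) (const (- 1ℤ)) ⟩
  (X^ 1 ⊛ S0 r F) ⊕ (const (- 1ℤ) ⊛ S0 r F)
    ≈⟨ ⊕-cong (X-⊛-S0 r F) (const-⊛ (- 1ℤ) (S0 r F)) ⟩
  S0 r ((X^ r ⊛ F) ⊕ ((- 1ℤ) · F))
    ≈⟨ S0-cong r (⊕-cong (≋-refl {X^ r ⊛ F}) (const-⊛ (- 1ℤ) F)) ⟨
  S0 r ((X^ r ⊛ F) ⊕ (const (- 1ℤ) ⊛ F))
    ≈⟨ S0-cong r (⊛-distribʳ F (X^ r) (const (- 1ℤ))) ⟨
  S0 r (xPowMinus1 r ⊛ F) ∎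

xMinus1^P-⊛-S0 : ∀ r .{{_ : NonZero r}} i F → (xMinus1 ^P i) ⊛ S0 r F ≋ S0 r ((xPowMinus1 r ^P i) ⊛ F)
xMinus1^P-⊛-S0 r zero    F = ≋-trans (*-identityˡ (S0 r F)) (S0-cong r (≋-sym (*-identityˡ F)))
xMinus1^P-⊛-S0 r (suc i) F = begin
  (xMinus1 ⊛ (xMinus1 ^P i)) ⊛ S0 r F ≈⟨ ⊛-assoc xMinus1 (xMinus1 ^P i) (S0 r F) ⟩
  xMinus1 ⊛ ((xMinus1 ^P i) ⊛ S0 r F) ≈⟨ ⊛-congˡ xMinus1 (xMinus1^P-⊛-S0 r i F) ⟩
  xMinus1 ⊛ S0 r (Y^i ⊛ F)            ≈⟨ xMinus1-⊛-S0 r (Y^i ⊛ F) ⟩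
  S0 r (xPowMinus1 r ⊛ (Y^i ⊛ F))     ≈⟨ S0-cong r (⊛-assoc (xPowMinus1 r) Y^i F) ⟨
  S0 r ((xPowMinus1 r ⊛ Y^i) ⊛ F)     ∎
  where
  Y^i = xPowMinus1 r ^P i

X^⊕geom≋geom-suc : ∀ r → X^ r ⊕ geom r ≋ geom (suc r)
X^⊕geom≋geom-suc zero    zero    = refl
X^⊕geom≋geom-suc zero    (suc m) = refl
X^⊕geom≋geom-suc (suc r) zero    = refl
X^⊕geom≋geom-suc (suc r) (suc m) = X^⊕geom≋geom-suc r m

xPowMinus1⊕geom≋X⊛geom : ∀ r .{{_ : NonZero r}} → xPowMinus1 r ⊕ geom r ≋ X^ 1 ⊛ geom r
xPowMinus1⊕geom≋X⊛geom (suc r) zero    = sym (X^-⊛-below 1 (geom (suc r)) 0 z<s)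
xPowMinus1⊕geom≋X⊛geom (suc r) (suc m) = trans
  (cong (ℤ._+ geom r m) (ℤ.+-identityʳ (X^ r m)))
  (trans (X^⊕geom≋geom-suc r m) (sym (X^-⊛-shift 1 (geom (suc r)) m)))

-1⊕geom≋geom₁ : ∀ r .{{_ : NonZero r}} → const (- 1ℤ) ⊕ geom r ≋ geom₁ r
-1⊕geom≋geom₁ (suc r) zero    = refl
-1⊕geom≋geom₁ (suc r) (suc m) = ℤ.+-identityˡ _

pF-formula : ∀ r .{{_ : NonZero r}} {n k} → k ≤ n → pF r n k ≋ S0 r (X^ k ⊛ (geom r ^P n))
pF-formula r {n} {k} k≤n = begin
  sumP k (λ i → (+ (k C i)) · ((xMinus1 ^P i) ⊛ S0 r (G ^P (n ∸ i))))
    ≈⟨ sumP-cong k (λ i _ → ·-cong (+ (k C i)) (xMinus1^P-⊛-S0 r i (G ^P (n ∸ i)))) ⟩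
  S0 r (sumP k (λ i → (+ (k C i)) · ((xPowMinus1 r ^P i) ⊛ (G ^P (n ∸ i)))))
    ≈⟨ S0-cong r (binomial-⊛ (xPowMinus1 r) G k≤n) ⟩
  S0 r ((G ^P (n ∸ k)) ⊛ ((xPowMinus1 r ⊕ G) ^P k))
    ≈⟨ S0-cong r (⊛-congˡ (G ^P (n ∸ k)) (^P-cong k (xPowMinus1⊕geom≋X⊛geom r))) ⟩
  S0 r ((G ^P (n ∸ k)) ⊛ ((X^ 1 ⊛ G) ^P k))
    ≈⟨ S0-cong r (⊛-congˡ (G ^P (n ∸ k)) (≋-trans (^P-distrib-⊛ (X^ 1) G k) (⊛-congʳ (G ^P k) (X^1-^P k)))) ⟩
  S0 r ((G ^P (n ∸ k)) ⊛ (X^ k ⊛ (G ^P k)))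
    ≈⟨ S0-cong r (⊛-left-comm (G ^P (n ∸ k)) (X^ k) (G ^P k)) ⟩
  S0 r (X^ k ⊛ ((G ^P (n ∸ k)) ⊛ (G ^P k)))
    ≈⟨ S0-cong r (⊛-congˡ (X^ k) (^P-+ G (n ∸ k) k)) ⟨
  S0 r (X^ k ⊛ (G ^P (n ∸ k + k)))
    ≈⟨ S0-cong r (λ m → cong (λ e → (X^ k ⊛ (G ^P e)) m) (ℕ.m∸n+n≡m k≤n)) ⟩
  S0 r (X^ k ⊛ (G ^P n)) ∎
  where
  G = geom r

alternating-sum-geom : ∀ r .{{_ : NonZero r}} {n k} → k ≤ n →
  sumP k (λ i → (sign i ℤ.* + (k C i)) · (geom r ^P (n ∸ i))) ≋ (geom r ^P (n ∸ k)) ⊛ (geom₁ r ^P k)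
alternating-sum-geom r {n} {k} k≤n = ≋-trans (alternating-binomial-⊛ (geom r) k≤n)
  (⊛-congˡ (geom r ^P (n ∸ k)) (^P-cong k (-1⊕geom≋geom₁ r)))

ℓF-formula : ∀ r .{{_ : NonZero r}} {n k} → k ≤ n → ℓF r n k ≋ S0 r ((geom r ^P (n ∸ k)) ⊛ (geom₁ r ^P k))
ℓF-formula r k≤n = S0-cong r (alternating-sum-geom r k≤n)

ℓF₂-formula : ∀ r .{{_ : NonZero r}} {n} k j → k + j ≤ n →
  ℓF₂ r n k j ≋ S0 r (X^ j ⊛ ((geom r ^P (n ∸ k)) ⊛ (geom₁ r ^P k)))
ℓF₂-formula r {n} k j k+j≤n = begin
  sumP k (λ i → c i · pF r (n ∸ i) j)
    ≈⟨ sumP-cong k (λ i i≤k → ·-cong (c i) (pF-formula r (j≤n∸i i≤k))) ⟩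
  S0 r (sumP k (λ i → c i · (X^ j ⊛ (G ^P (n ∸ i)))))
    ≈⟨ S0-cong r (sumP-cong k (λ i _ → ⊛-· (X^ j) (c i) (G ^P (n ∸ i)))) ⟨
  S0 r (sumP k (λ i → X^ j ⊛ (c i · (G ^P (n ∸ i)))))
    ≈⟨ S0-cong r (⊛-sumP (X^ j) k (λ i → c i · (G ^P (n ∸ i)))) ⟨
  S0 r (X^ j ⊛ sumP k (λ i → c i · (G ^P (n ∸ i))))
    ≈⟨ S0-cong r (⊛-congˡ (X^ j) (alternating-sum-geom r (ℕ.m+n≤o⇒m≤o k k+j≤n))) ⟩
  S0 r (X^ j ⊛ ((G ^P (n ∸ k)) ⊛ (geom₁ r ^P k))) ∎
  where
  G = geom r
  c : ℕ → ℤ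
  c i = sign i ℤ.* + (k C i)
  j≤n∸i : ∀ {i} → i ≤ k → j ≤ n ∸ i
  j≤n∸i {i} i≤k = ℕ.m+n≤o⇒m≤o∸n j
    (ℕ.≤-trans (ℕ.≤-reflexive (ℕ.+-comm j i)) (ℕ.≤-trans (ℕ.+-monoˡ-≤ j i≤k) k+j≤n))

proposition5p1 : (n r : ℕ) → 1 ≤ n → 1 ≤ r → n ≤ r →
    ((k : ℕ) → k ≤ n →
       (pF r n k ≋ S0 r (X^ k ⊛ (geom r ^P n)))
       × (ℓF r n k ≋ S0 r ((geom r ^P (n ∸ k)) ⊛ (geom₁ r ^P k))))
    × ((k j : ℕ) → k + j ≤ n →
       ℓF₂ r n k j ≋ S0 r (X^ j ⊛ ((geom r ^P (n ∸ k)) ⊛ (geom₁ r ^P k))))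
proposition5p1 n (suc r) _ _ _ =
  (λ k k≤n → pF-formula (suc r) k≤n , ℓF-formula (suc r) k≤n) ,
  (λ k j k+j≤n → ℓF₂-formula (suc r) k j k+j≤n)
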